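{- Let $J_1,\dots,J_p$ be subsets of $\{1,\dots,n\}$ and suppose there is a permutation $\sigma$ of $\{1,\dots,p\}$ such that $|J_{\sigma(i)}\cap J_{\sigma(i+1)}|\ge 2$ for all $1\le i<p$. Then $\bigcap_{i=1}^p D_{J_i}=D_{\bigcup_{i=1}^p J_i}$.
   Context: Fix $n$ pairwise non-parallel affine lines $H^0_i=\{\alpha^i\cdot y=c_i\}\subset\mathbb C^2$ (i.e. with $n$ distinct points at infinity). The space of parallel translates is $\mathbb C^n$, $x\mapsto\{H_i(x)=\{\alpha^i\cdot y=x_i\}\}$. For $J\subset\{1,\dots,n\}$, $D_J=\{x\in\mathbb C^n:\bigcap_{i\in J}H_i(x)\ne\emptyset\}$; for $|J|\ge3$ this is the intersection of the hyperplanes $D_K$, $K\subset J$, $|K|=3$, of the discriminantal arrangement $\mathcal B(n,2,\mathcal A_\infty)$. -}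

module Defs where

open import Level using (Level)
open import Data.Nat using (ℕ; suc)
open import Data.Fin using (Fin; toℕ)
open import Data.Fin.Subset using (Subset; _∈_; ⋃)
open import Data.List using (List)
import Data.List as List
open import Data.Product using (Σ; ∃; _×_; _,_)
open import Relation.Nullary using (¬_)
import Data.Product
open import Relation.Binary.PropositionalEquality using (_≡_)
open import Algebra.Bundles using (CommutativeRing)

record IsField {c ℓ : Level} (K : CommutativeRing c ℓ) : Set (c Level.⊔ ℓ) where
  open CommutativeRing K
  field
    nontrivial : ¬ (1# ≈ 0#)
    inverse    : ∀ x → ¬ (x ≈ 0#) → ∃ λ y → x * y ≈ 1#

module Arrangement {c ℓ : Level} (K : CommutativeRing c ℓ) where
  open CommutativeRing K

  Point : Set c
  Point = Carrier × Carrier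

  dot : Point → Point → Carrier
  dot (a₁ , a₂) (y₁ , y₂) = a₁ * y₁ + a₂ * y₂

  -- determinant of (α, β); the lines {α·y = c}, {β·y = d} are non-parallel iff det ≠ 0
  det : Point → Point → Carrier
  det (a₁ , a₂) (b₁ , b₂) = a₁ * b₂ - a₂ * b₁

  -- y ∈ H_i(x) = {α^i · y = x_i}
  onLine : {n : ℕ} → (Fin n → Point) → (Fin n → Carrier) → Fin n → Point → Set ℓ
  onLine α x i y = dot (α i) y ≈ x i

  -- D_J = { x : ⋂_{i∈J} H_i(x) ≠ ∅ }
  D : {n : ℕ} → (Fin n → Point) → Subset n → (Fin n → Carrier) → Set (c Level.⊔ ℓ)
  D α J x = ∃ λ y → ∀ i → i ∈ J → onLine α x i y

⋃ᶠ : {n p : ℕ} → (Fin p → Subset n) → Subset n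
⋃ᶠ {p = p} J = ⋃ (List.tabulate {n = p} J)

module Hyp {c ℓ : Level} (K : CommutativeRing c ℓ) where
  open CommutativeRing K
  open Arrangement K

  -- each α^i is a nonzero covector (so H_i is a genuine line)
  NonzeroCovectors : {n : ℕ} → (Fin n → Point) → Set ℓ
  NonzeroCovectors α = ∀ i → ¬ ((Data.Product.proj₁ (α i) ≈ 0#) × (Data.Product.proj₂ (α i) ≈ 0#))

  PairwiseNonParallel : {n : ℕ} → (Fin n → Point) → Set ℓ
  PairwiseNonParallel α = ∀ i j → ¬ (i ≡ j) → ¬ (det (α i) (α j) ≈ 0#)

-- Two non-parallel lines meet in at most one point. If J and J' share two
-- indices, a point of ⋂_{i∈J} H_i(x) and a point of ⋂_{i∈J'} H_i(x) both lie on
-- two non-parallel lines, so they coincide. Following σ, all the sets J_k are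
-- linked by such overlaps, hence all their intersection points coincide, and that
-- single point lies on every line H_i(x) with i ∈ ⋃ J_k.
module Submission where

open import Level using (Level)
open import Algebra.Bundles using (CommutativeRing)
open import Data.Nat using (ℕ; zero; suc; _≤_; s≤s)
open import Data.Fin using (Fin; zero; suc; toℕ)
open import Data.Fin.Subset using (Subset; _∈_; _∩_; _⊆_; ∣_∣; inside; outside; Nonempty)
open import Data.Fin.Subset.Properties using (x∈p∩q⁻; x∈p∪q⁻; x∈p∪q⁺; ∉⊥)
open import Data.Fin.Permutation using (Permutation′; _⟨$⟩ʳ_; _⟨$⟩ˡ_; inverseʳ)
open import Data.Fin.Properties using (suc-injective)
open import Data.Product using (Σ; ∃; _×_; _,_; proj₁; proj₂)
open import Data.Product.Relation.Binary.Pointwise.NonDependent using (×-setoid)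
open import Data.Sum using (inj₁; inj₂)
open import Data.Vec using (_∷_; here; there)
open import Data.Empty using (⊥-elim)
open import Function using (_∘_; _⇔_; mk⇔)
open import Relation.Nullary using (¬_)
open import Relation.Binary.Bundles using (Setoid)
open import Relation.Binary.PropositionalEquality as ≡ using (_≡_)
open import Defs

1≤∣p∣⇒Nonempty : ∀ {n} (p : Subset n) → 1 ≤ ∣ p ∣ → Nonempty p
1≤∣p∣⇒Nonempty (inside  ∷ p) _ = zero , here
1≤∣p∣⇒Nonempty (outside ∷ p) h with 1≤∣p∣⇒Nonempty p h
... | x , x∈p = suc x , there x∈p

2≤∣p∣⇒distinct-members : ∀ {n} (p : Subset n) → 2 ≤ ∣ p ∣ →
                         Σ (Fin n) λ x → Σ (Fin n) λ y → ¬ x ≡ y × x ∈ p × y ∈ p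
2≤∣p∣⇒distinct-members (inside ∷ p) (s≤s h) with 1≤∣p∣⇒Nonempty p h
... | y , y∈p = zero , suc y , (λ ()) , here , there y∈p
2≤∣p∣⇒distinct-members (outside ∷ p) h with 2≤∣p∣⇒distinct-members p h
... | x , y , x≢y , x∈p , y∈p = suc x , suc y , x≢y ∘ suc-injective , there x∈p , there y∈p

x∈⋃ᶠ⁻ : ∀ {n p} (J : Fin p → Subset n) {x} → x ∈ ⋃ᶠ J → ∃ λ k → x ∈ J k
x∈⋃ᶠ⁻ {p = zero}  J x∈⋃ = ⊥-elim (∉⊥ x∈⋃)
x∈⋃ᶠ⁻ {p = suc p} J x∈⋃ with x∈p∪q⁻ (J zero) (⋃ᶠ (J ∘ suc)) x∈⋃
... | inj₁ x∈J₀ = zero , x∈J₀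
... | inj₂ x∈⋃′ with x∈⋃ᶠ⁻ (J ∘ suc) x∈⋃′
...   | k , x∈Jₖ = suc k , x∈Jₖ

x∈⋃ᶠ⁺ : ∀ {n p} (J : Fin p → Subset n) k → J k ⊆ ⋃ᶠ J
x∈⋃ᶠ⁺ J zero    x∈J₀ = x∈p∪q⁺ (inj₁ x∈J₀)
x∈⋃ᶠ⁺ J (suc k) x∈Jₖ = x∈p∪q⁺ (inj₂ (x∈⋃ᶠ⁺ (J ∘ suc) k x∈Jₖ))

module _ {a ℓ} (S : Setoid a ℓ) where
  open Setoid S

  Linked : ∀ {p} → (Fin p → Carrier) → Set ℓ
  Linked g = ∀ i j → toℕ j ≡ suc (toℕ i) → g i ≈ g j

  linked⇒≈-first : ∀ {p} (g : Fin (suc p) → Carrier) → Linked g → ∀ k → g zero ≈ g k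
  linked⇒≈-first         g linked zero    = refl
  linked⇒≈-first {suc p} g linked (suc k) =
    trans (linked zero (suc zero) ≡.refl)
          (linked⇒≈-first (g ∘ suc) (λ i j e → linked (suc i) (suc j) (≡.cong suc e)) k)

  linked-along-permutation⇒≈ : ∀ {p} (σ : Permutation′ p) (f : Fin p → Carrier) →
                               Linked (f ∘ (σ ⟨$⟩ʳ_)) → ∀ k l → f k ≈ f l
  linked-along-permutation⇒≈ {zero}  σ f linked () l
  linked-along-permutation⇒≈ {suc p} σ f linked k l = trans (sym (≈-first k)) (≈-first l)
    where
    ≈-first : ∀ k → f (σ ⟨$⟩ʳ zero) ≈ f k
    ≈-first k = trans (linked⇒≈-first (f ∘ (σ ⟨$⟩ʳ_)) linked (σ ⟨$⟩ˡ k))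
                      (reflexive (≡.cong f (inverseʳ σ)))

module Lines {c ℓ : Level} (K : CommutativeRing c ℓ) where
  open CommutativeRing K hiding (zero)
  open Arrangement K
  open Hyp K using (PairwiseNonParallel)
  open import Relation.Binary.Reasoning.Setoid setoid
  open import Algebra.Solver.Ring.NaturalCoefficients.Default commutativeSemiring
  open import Algebra.Properties.Group +-group using (∙-cancelʳ)

  Point-setoid : Setoid c ℓ
  Point-setoid = ×-setoid setoid setoid

  open Setoid Point-setoid using () renaming (_≈_ to _≈ₚ_)

  dot-congˡ : ∀ a {y z} → y ≈ₚ z → dot a y ≈ dot a z
  dot-congˡ a (y₁≈z₁ , y₂≈z₂) = +-cong (*-congˡ y₁≈z₁) (*-congˡ y₂≈z₂)

  onLine-resp : ∀ {n} (α : Fin n → Point) x i {y z} → y ≈ₚ z → onLine α x i y → onLine α x i z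
  onLine-resp α x i y≈z on = trans (sym (dot-congˡ (α i) y≈z)) on

  *-cancelˡ-≉0 : IsField K → ∀ d {u w} → ¬ d ≈ 0# → d * u ≈ d * w → u ≈ w
  *-cancelˡ-≉0 F d {u} {w} d≉0 du≈dw with IsField.inverse F d d≉0
  ... | e , de≈1 = begin
    u           ≈⟨ sym (*-identityˡ u) ⟩
    1# * u      ≈⟨ *-congʳ (sym de≈1) ⟩
    (d * e) * u ≈⟨ undo u ⟩
    e * (d * u) ≈⟨ *-congˡ du≈dw ⟩
    e * (d * w) ≈⟨ sym (undo w) ⟩
    (d * e) * w ≈⟨ *-congʳ de≈1 ⟩
    1# * w      ≈⟨ *-identityˡ w ⟩
    w           ∎
    where
    undo : ∀ v → (d * e) * v ≈ e * (d * v)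
    undo v = trans (*-congʳ (*-comm d e)) (*-assoc e d v)

  +-vanishing : ∀ r q y → r + (- q + q) * y ≈ r
  +-vanishing r q y = begin
    r + (- q + q) * y ≈⟨ +-congˡ (*-congʳ (-‿inverseˡ q)) ⟩
    r + 0# * y        ≈⟨ +-congˡ (zeroˡ y) ⟩
    r + 0#            ≈⟨ +-identityʳ r ⟩
    r                 ∎

  -- det contains a subtraction, invisible to the semiring solver: each identity is
  -- solved with -(a₂ b₁) abstracted as t, and then t + a₂ b₁ ≈ 0 is used.
  cramer₁ : ∀ a₁ a₂ b₁ b₂ y₁ y₂ →
            det (a₁ , a₂) (b₁ , b₂) * y₁ + a₂ * dot (b₁ , b₂) (y₁ , y₂) ≈ b₂ * dot (a₁ , a₂) (y₁ , y₂)
  cramer₁ a₁ a₂ b₁ b₂ y₁ y₂ = trans (shape a₁ a₂ b₁ b₂ (- (a₂ * b₁)) y₁ y₂) (+-vanishing _ _ _)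
    where
    shape : ∀ a₁ a₂ b₁ b₂ t y₁ y₂ →
            (a₁ * b₂ + t) * y₁ + a₂ * (b₁ * y₁ + b₂ * y₂) ≈ b₂ * (a₁ * y₁ + a₂ * y₂) + (t + a₂ * b₁) * y₁
    shape = solve 7 (λ a₁ a₂ b₁ b₂ t y₁ y₂ →
      (a₁ :* b₂ :+ t) :* y₁ :+ a₂ :* (b₁ :* y₁ :+ b₂ :* y₂) := b₂ :* (a₁ :* y₁ :+ a₂ :* y₂) :+ (t :+ a₂ :* b₁) :* y₁) refl

  cramer₂ : ∀ a₁ a₂ b₁ b₂ y₁ y₂ →
            det (a₁ , a₂) (b₁ , b₂) * y₂ + b₁ * dot (a₁ , a₂) (y₁ , y₂) ≈ a₁ * dot (b₁ , b₂) (y₁ , y₂)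
  cramer₂ a₁ a₂ b₁ b₂ y₁ y₂ = trans (shape a₁ a₂ b₁ b₂ (- (a₂ * b₁)) y₁ y₂) (+-vanishing _ _ _)
    where
    shape : ∀ a₁ a₂ b₁ b₂ t y₁ y₂ →
            (a₁ * b₂ + t) * y₂ + b₁ * (a₁ * y₁ + a₂ * y₂) ≈ a₁ * (b₁ * y₁ + b₂ * y₂) + (t + a₂ * b₁) * y₂
    shape = solve 7 (λ a₁ a₂ b₁ b₂ t y₁ y₂ →
      (a₁ :* b₂ :+ t) :* y₂ :+ b₁ :* (a₁ :* y₁ :+ a₂ :* y₂) := a₁ :* (b₁ :* y₁ :+ b₂ :* y₂) :+ (t :+ a₂ :* b₁) :* y₂) refl

  det≉0⇒lines-meet-once : IsField K → ∀ a b {y z} → ¬ det a b ≈ 0# →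
                          dot a y ≈ dot a z → dot b y ≈ dot b z → y ≈ₚ z
  det≉0⇒lines-meet-once F (a₁ , a₂) (b₁ , b₂) {y₁ , y₂} {z₁ , z₂} det≉0 ay≈az by≈bz =
    *-cancelˡ-≉0 F _ det≉0 (∙-cancelʳ _ _ _ (begin
      _ ≈⟨ cramer₁ a₁ a₂ b₁ b₂ y₁ y₂ ⟩
      _ ≈⟨ *-congˡ ay≈az ⟩
      _ ≈⟨ sym (cramer₁ a₁ a₂ b₁ b₂ z₁ z₂) ⟩
      _ ≈⟨ +-congˡ (*-congˡ (sym by≈bz)) ⟩
      _ ∎)) ,
    *-cancelˡ-≉0 F _ det≉0 (∙-cancelʳ _ _ _ (begin
      _ ≈⟨ cramer₂ a₁ a₂ b₁ b₂ y₁ y₂ ⟩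
      _ ≈⟨ *-congˡ by≈bz ⟩
      _ ≈⟨ sym (cramer₂ a₁ a₂ b₁ b₂ z₁ z₂) ⟩
      _ ≈⟨ +-congˡ (*-congˡ (sym ay≈az)) ⟩
      _ ∎))

  D-antitone : ∀ {n} (α : Fin n → Point) x {J J′} → J ⊆ J′ → D α J′ x → D α J x
  D-antitone α x J⊆J′ (y , on) = y , λ i i∈J → on i (J⊆J′ i∈J)

  two-shared-lines⇒same-point : IsField K → ∀ {n} {α : Fin n → Point} → PairwiseNonParallel α →
                                ∀ {J J′ x} → 2 ≤ ∣ J ∩ J′ ∣ →
                                (u : D α J x) (v : D α J′ x) → proj₁ u ≈ₚ proj₁ v
  two-shared-lines⇒same-point F {α = α} nonParallel {J} {J′} shared (y , on) (z , on′)
    with 2≤∣p∣⇒distinct-members (J ∩ J′) shared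
  ... | i , j , i≢j , i∈ , j∈ with x∈p∩q⁻ J J′ i∈ | x∈p∩q⁻ J J′ j∈
  ...   | i∈J , i∈J′ | j∈J , j∈J′ =
    det≉0⇒lines-meet-once F (α i) (α j) (nonParallel i j i≢j)
      (trans (on i i∈J) (sym (on′ i i∈J′)))
      (trans (on j j∈J) (sym (on′ j j∈J′)))

  same-point⇒D-⋃ᶠ : ∀ {n p} (α : Fin n → Point) x (J : Fin p → Subset n) (w : ∀ k → D α (J k) x) →
                    (∀ k l → proj₁ (w k) ≈ₚ proj₁ (w l)) → D α (⋃ᶠ J) x
  same-point⇒D-⋃ᶠ {p = zero}  α x J w agree = (0# , 0#) , λ i i∈⊥ → ⊥-elim (∉⊥ i∈⊥)
  same-point⇒D-⋃ᶠ {p = suc p} α x J w agree = proj₁ (w zero) , on-all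
    where
    on-all : ∀ i → i ∈ ⋃ᶠ J → onLine α x i (proj₁ (w zero))
    on-all i i∈⋃ with x∈⋃ᶠ⁻ J i∈⋃
    ... | k , i∈Jₖ = onLine-resp α x i (agree k zero) (proj₂ (w k) i i∈Jₖ)

-- NonzeroCovectors is unused: it follows from PairwiseNonParallel once n ≥ 2.
lemma5p2 : {c ℓ : Level} (K : CommutativeRing c ℓ) → IsField K →
    (n : ℕ) (α : Fin n → Arrangement.Point K) →
    Hyp.NonzeroCovectors K α →
    Hyp.PairwiseNonParallel K α →
    (p : ℕ) (J : Fin p → Subset n) (σ : Permutation′ p) →
    (∀ (i j : Fin p) → toℕ j ≡ suc (toℕ i) → 2 ≤ ∣ J (σ ⟨$⟩ʳ i) ∩ J (σ ⟨$⟩ʳ j) ∣) →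
    (x : Fin n → CommutativeRing.Carrier K) →
    ((∀ k → Arrangement.D K α (J k) x) ⇔ Arrangement.D K α (⋃ᶠ J) x)
lemma5p2 K F n α _ nonParallel p J σ shared x = mk⇔ glue restrict
  where
  open Arrangement K using (D)
  open Lines K

  glue : (∀ k → D α (J k) x) → D α (⋃ᶠ J) x
  glue w = same-point⇒D-⋃ᶠ α x J w
    (linked-along-permutation⇒≈ Point-setoid σ (proj₁ ∘ w)
      (λ i j j≡1+i → two-shared-lines⇒same-point F nonParallel (shared i j j≡1+i) (w _) (w _)))

  restrict : D α (⋃ᶠ J) x → ∀ k → D α (J k) x
  restrict d k = D-antitone α x (x∈⋃ᶠ⁺ J k) d
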